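{- Let $G$ be a weak induced subhypergraph of a hypergraph $H$ such that $|E(G)|=|E(H)|$ and $E(G)$ contains no singleton edges. Then $b(G)\leq b(H)$.
   Context: A hypergraph $H$ consists of a nonempty finite vertex set $V(H)$ and a finite family $E(H)$ of edges, each a subset of $V(H)$; parallel and singleton edges are allowed. The weak subhypergraph induced by a nonempty set $V'\subseteq V(H)$ has vertex set $V'$ and edge family consisting of $e\cap V'$ for each $e\in E(H)$ with $e\cap V'\neq\emptyset$ (one edge for each such $e$, counted with multiplicity); a weak induced subhypergraph is one of this form. Round-based burning: let $F_0=\emptyset$. In each round $r=1,2,\ldots$ simultaneously: every vertex $v\notin F_{r-1}$ for which there is an edge $e$ with $|e|\geq 2$, $v\in e$ and $e\setminus\{v\}\subseteq F_{r-1}$ catches fire; and a chosen vertex $u_r\notin F_{r-1}$ (a source) is set on fire. $F_r$ is $F_{r-1}$ together with all vertices set on fire in round $r$. A sequence $(u_1,\ldots,u_k)$ with $u_r\notin F_{r-1}$ for all $r$ and $F_k=V(H)$ is a burning sequence; $b(H)$ is the minimum length of a burning sequence. -}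

module Defs where

open import Data.Nat using (ℕ; zero; suc; _≤_)
open import Data.Fin using (Fin)
open import Data.Fin.Subset using (Subset; _∈_; _∉_; _⊆_; _∩_; ∣_∣; Nonempty)
open import Data.Fin.Subset.Properties using (nonempty?; p∩q⊆q)
open import Data.List using (List; []; _∷_; map; filter; length)
open import Data.List.Membership.Propositional renaming (_∈_ to _∈ₗ_)
open import Data.List.Relation.Unary.All using (All; []; _∷_)
open import Data.Maybe using (Maybe; just; nothing)
open import Data.Product using (Σ; _×_; _,_)
open import Data.Sum using (_⊎_)
open import Data.Empty using (⊥)
open import Relation.Binary.PropositionalEquality using (_≡_; _≢_)
open import Relation.Nullary using (¬_)

-- Edges form a family (list, so parallel edges
-- are allowed), each edge a subset of the vertex set.
record Hypergraph (n : ℕ) : Set where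
  field
    V        : Subset n
    V-nonempty : Nonempty V
    E        : List (Subset n)
    E⊆V      : All (_⊆ V) E
open Hypergraph public

-- Edges of the weak subhypergraph induced by V' : e ∩ V' for each e with
-- e ∩ V' nonempty, with multiplicity.
inducedEdges : ∀ {n} → List (Subset n) → Subset n → List (Subset n)
inducedEdges E V' = map (_∩ V') (filter (λ e → nonempty? (e ∩ V')) E)

private
  inducedEdges⊆ : ∀ {n} (E : List (Subset n)) (V' : Subset n) →
                  All (_⊆ V') (map (_∩ V') E)
  inducedEdges⊆ [] V' = []
  inducedEdges⊆ (e ∷ E) V' = p∩q⊆q e V' ∷ inducedEdges⊆ E V'

weakInduced : ∀ {n} (H : Hypergraph n) (V' : Subset n) →
              Nonempty V' → V' ⊆ V H → Hypergraph n
weakInduced H V' ne _ = record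
  { V = V' ; V-nonempty = ne ; E = inducedEdges (E H) V'
  ; E⊆V = inducedEdges⊆ (filter (λ e → nonempty? (e ∩ V')) (E H)) V' }

nth : ∀ {A : Set} → List A → ℕ → Maybe A
nth []       _       = nothing
nth (x ∷ xs) zero    = just x
nth (x ∷ xs) (suc r) = nth xs r

-- Fire H us r v : vertex v is on fire after round r (i.e. v ∈ F_r) when the
-- sources chosen are us = (u_1, ..., u_k) (round r+1 uses nth us r).
Fire : ∀ {n} → Hypergraph n → List (Fin n) → ℕ → Fin n → Set
Fire {n} H us zero    v = ⊥
Fire {n} H us (suc r) v =
  Fire H us r v
  ⊎ (Σ (Subset n) λ e → e ∈ₗ E H × 2 ≤ ∣ e ∣ × v ∈ e ×
       (∀ w → w ∈ e → w ≢ v → Fire H us r w))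
  ⊎ nth us r ≡ just v

IsBurningSeq : ∀ {n} → Hypergraph n → List (Fin n) → Set
IsBurningSeq H us =
  (∀ r u → nth us r ≡ just u → u ∈ V H × ¬ Fire H us r u)
  × (∀ v → (v ∈ V H → Fire H us (length us) v) × (Fire H us (length us) v → v ∈ V H))

IsBurningNumber : ∀ {n} → Hypergraph n → ℕ → Set
IsBurningNumber H b =
  (Σ (List _) λ us → IsBurningSeq H us × length us ≡ b)
  × (∀ us → IsBurningSeq H us → b ≤ length us)

-- Run a burning sequence of H and copy it into G round by round: whenever
-- H's source lies in V' and is still unburnt in G it becomes G's source,
-- otherwise G sets fire to some other unburnt vertex of V', and G stops once
-- V' is burnt.  An edge e of H that burns v ∈ V' restricts to the edge e ∩ V'
-- of G, which contains v and has at least two vertices because G has no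
-- singleton edges; so by induction every vertex of V' burns in G no later
-- than in H, and G is burnt after at most as many rounds as H.
module Submission where

open import Defs
open import Data.Nat using (ℕ; zero; suc; _≤_; _<_; _≤?_; z≤n; s≤s)
open import Data.Nat.Properties using (≤-refl; ≤-reflexive; ≤-trans; <-≤-trans; m≤n⇒m≤1+n; <⇒≤; ≤∧≢⇒<)
open import Data.Fin using (Fin) renaming (_≟_ to _≟ᶠ_)
open import Data.Fin.Properties using (all?) renaming (any? to anyFin?)
open import Data.Fin.Subset using (Subset; _∈_; _⊆_; _∩_; ∣_∣; Nonempty)
open import Data.Fin.Subset.Properties using (_∈?_; x∈p∩q⁺; x∈p∩q⁻; nonempty?; x∈p⇒∣p-x∣<∣p∣)
open import Data.List using (List; []; _∷_; _++_; _∷ʳ_; length)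
open import Data.List.Membership.Propositional renaming (_∈_ to _∈ₗ_) using (find; lose)
open import Data.List.Membership.Propositional.Properties using (∈-map⁺; ∈-filter⁺)
open import Data.List.Relation.Unary.All using (All) renaming (lookup to All-lookup)
open import Data.List.Relation.Unary.Any using (any?)
open import Data.Maybe using (Maybe; just; nothing)
open import Data.Maybe.Properties using (≡-dec)
open import Data.Product using (Σ; ∃; _×_; _,_; proj₁; proj₂)
open import Data.Sum using (_⊎_; inj₁; inj₂; [_,_]′)
open import Data.Empty using (⊥-elim)
open import Function using (_∘_)
open import Relation.Binary.PropositionalEquality using (_≡_; _≢_; refl; sym; trans; cong; subst; ≢-sym)
open import Relation.Nullary using (¬_; Dec; yes; no)
open import Relation.Nullary.Decidable using (_×-dec_; _⊎-dec_; _→-dec_; ¬?; map′; decidable-stable)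
open import Relation.Unary using (Decidable)

nth-++ˡ : ∀ {A : Set} (xs ys : List A) {i} → i < length xs → nth (xs ++ ys) i ≡ nth xs i
nth-++ˡ (x ∷ xs) ys {zero}  _         = refl
nth-++ˡ (x ∷ xs) ys {suc i} (s≤s i<n) = nth-++ˡ xs ys i<n

nth-∷ʳ-length : ∀ {A : Set} (xs : List A) x → nth (xs ∷ʳ x) (length xs) ≡ just x
nth-∷ʳ-length []       x = refl
nth-∷ʳ-length (_ ∷ xs) x = nth-∷ʳ-length xs x

nth-∷ʳ⁻ : ∀ {A : Set} (xs : List A) x i {y} → nth (xs ∷ʳ x) i ≡ just y →
          (i < length xs × nth xs i ≡ just y) ⊎ (i ≡ length xs × y ≡ x)
nth-∷ʳ⁻ []       x zero    refl = inj₂ (refl , refl)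
nth-∷ʳ⁻ []       x (suc i) ()
nth-∷ʳ⁻ (_ ∷ xs) x zero    eq   = inj₁ (s≤s z≤n , eq)
nth-∷ʳ⁻ (_ ∷ xs) x (suc i) eq with nth-∷ʳ⁻ xs x i eq
... | inj₁ (i<n , eq′)  = inj₁ (s≤s i<n , eq′)
... | inj₂ (refl , y≡x) = inj₂ (refl , y≡x)

length-∷ʳ : ∀ {A : Set} (xs : List A) x → length (xs ∷ʳ x) ≡ suc (length xs)
length-∷ʳ []       x = refl
length-∷ʳ (_ ∷ xs) x = cong suc (length-∷ʳ xs x)

module _ {n} (K : Hypergraph n) where

  ValidSources : List (Fin n) → Set
  ValidSources us = ∀ r u → nth us r ≡ just u → u ∈ V K × ¬ Fire K us r u

  Fire-prefix : ∀ {us us′} r → (∀ i → i < r → nth us i ≡ nth us′ i) →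
                ∀ {v} → Fire K us r v → Fire K us′ r v
  Fire-prefix (suc r) agree (inj₁ f) = inj₁ (Fire-prefix r (λ i i<r → agree i (m≤n⇒m≤1+n i<r)) f)
  Fire-prefix (suc r) agree (inj₂ (inj₁ (e , e∈ , 2≤∣e∣ , v∈e , burnt))) =
    inj₂ (inj₁ (e , e∈ , 2≤∣e∣ , v∈e ,
      λ w w∈e w≢v → Fire-prefix r (λ i i<r → agree i (m≤n⇒m≤1+n i<r)) (burnt w w∈e w≢v)))
  Fire-prefix (suc r) agree (inj₂ (inj₂ eq)) = inj₂ (inj₂ (trans (sym (agree r ≤-refl)) eq))

  Fire-∷ʳ⁺ : ∀ ps c {r v} → r ≤ length ps → Fire K ps r v → Fire K (ps ∷ʳ c) r v
  Fire-∷ʳ⁺ ps c {r} r≤n = Fire-prefix r λ i i<r → sym (nth-++ˡ ps _ (<-≤-trans i<r r≤n))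

  Fire-∷ʳ⁻ : ∀ ps c {r v} → r ≤ length ps → Fire K (ps ∷ʳ c) r v → Fire K ps r v
  Fire-∷ʳ⁻ ps c {r} r≤n = Fire-prefix r λ i i<r → nth-++ˡ ps _ (<-≤-trans i<r r≤n)

  fire? : ∀ us r v → Dec (Fire K us r v)
  fire? us zero    v = no λ ()
  fire? us (suc r) v = fire? us r v ⊎-dec spread? ⊎-dec ≡-dec _≟ᶠ_ (nth us r) (just v)
    where
    spread? = map′ find (λ (_ , e∈ , p) → lose e∈ p)
      (any? (λ e → (2 ≤? ∣ e ∣) ×-dec (v ∈? e) ×-dec
                   all? (λ w → (w ∈? e) →-dec ¬? (w ≟ᶠ v) →-dec fire? us r w))
            (E K))

  Fire⊆V : ∀ {us} → ValidSources us → ∀ r {v} → Fire K us r v → v ∈ V K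
  Fire⊆V valid (suc r) (inj₁ f)                          = Fire⊆V valid r f
  Fire⊆V valid (suc r) (inj₂ (inj₁ (_ , e∈ , _ , v∈e , _))) = All-lookup (E⊆V K) e∈ v∈e
  Fire⊆V valid (suc r) (inj₂ (inj₂ eq))                  = proj₁ (valid r _ eq)

  ValidSources-∷ʳ : ∀ {ps c} → ValidSources ps → c ∈ V K → ¬ Fire K ps (length ps) c →
                    ValidSources (ps ∷ʳ c)
  ValidSources-∷ʳ {ps} {c} valid c∈V c-unburnt i u eq with nth-∷ʳ⁻ ps c i eq
  ... | inj₁ (i<n , eq′) =
    proj₁ (valid i u eq′) , λ f → proj₂ (valid i u eq′) (Fire-∷ʳ⁻ ps c (<⇒≤ i<n) f)
  ... | inj₂ (refl , refl) = c∈V , λ f → c-unburnt (Fire-∷ʳ⁻ ps c ≤-refl f)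

  isBurningSeq : ∀ {us} → ValidSources us → (∀ v → v ∈ V K → Fire K us (length us) v) →
                 IsBurningSeq K us
  isBurningSeq valid burnt = valid , λ v → burnt v , Fire⊆V valid _

preferSource : ∀ {n} (S : Subset n) {B : Fin n → Set} → Decidable B →
               (m : Maybe (Fin n)) (w : Fin n) → w ∈ S → ¬ B w →
               Σ (Fin n) λ c → c ∈ S × ¬ B c × (∀ v → v ∈ S → m ≡ just v → B v ⊎ v ≡ c)
preferSource S B? nothing  w w∈S ¬Bw = w , w∈S , ¬Bw , λ _ _ ()
preferSource S B? (just u) w w∈S ¬Bw with u ∈? S | B? u
... | yes u∈S | no ¬Bu = u , u∈S , ¬Bu , λ { _ _ refl → inj₂ refl }
... | yes _   | yes Bu = w , w∈S , ¬Bw , λ { _ _ refl → inj₁ Bu }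
... | no u∉S  | _      = w , w∈S , ¬Bw , λ { _ u∈S refl → ⊥-elim (u∉S u∈S) }

∈-inducedEdges : ∀ {n} {E : List (Subset n)} {V′ e : Subset n} {v} →
                 e ∈ₗ E → v ∈ e → v ∈ V′ → e ∩ V′ ∈ₗ inducedEdges E V′
∈-inducedEdges {V′ = V′} e∈E v∈e v∈V′ =
  ∈-map⁺ (_∩ V′) (∈-filter⁺ (λ e → nonempty? (e ∩ V′)) e∈E (_ , x∈p∩q⁺ (v∈e , v∈V′)))

2≤∣p∣ : ∀ {n} {p : Subset n} {x} → x ∈ p → ∣ p ∣ ≢ 1 → 2 ≤ ∣ p ∣
2≤∣p∣ x∈p ∣p∣≢1 = ≤∧≢⇒< (≤-trans (s≤s z≤n) (x∈p⇒∣p-x∣<∣p∣ x∈p)) (≢-sym ∣p∣≢1)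

module Simulation {n} (H : Hypergraph n) (V′ : Subset n) (ne : Nonempty V′) (sub : V′ ⊆ V H)
  (noSingleton : All (λ e → ∣ e ∣ ≢ 1) (E (weakInduced H V′ ne sub)))
  (us : List (Fin n)) where

  G : Hypergraph n
  G = weakInduced H V′ ne sub

  Dominates : List (Fin n) → ℕ → Set
  Dominates ps r = ∀ v → v ∈ V′ → Fire H us r v → Fire G ps r v

  dominates-suc : ∀ {ps} r → Dominates ps r →
                  (∀ v → v ∈ V′ → nth us r ≡ just v → Fire G ps r v ⊎ nth ps r ≡ just v) →
                  Dominates ps (suc r)
  dominates-suc r dom _ v v∈V′ (inj₁ f) = inj₁ (dom v v∈V′ f)
  dominates-suc r dom _ v v∈V′ (inj₂ (inj₁ (e , e∈ , _ , v∈e , burnt))) =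
    inj₂ (inj₁ (e ∩ V′ , e∩V′∈ , 2≤∣p∣ v∈e∩V′ (All-lookup noSingleton e∩V′∈) , v∈e∩V′ , burnt′))
    where
    v∈e∩V′ = x∈p∩q⁺ (v∈e , v∈V′)
    e∩V′∈ = ∈-inducedEdges e∈ v∈e v∈V′
    burnt′ : ∀ w → w ∈ e ∩ V′ → w ≢ v → Fire G _ r w
    burnt′ w w∈ w≢v = let w∈e , w∈V′ = x∈p∩q⁻ e V′ w∈ in dom w w∈V′ (burnt w w∈e w≢v)
  dominates-suc r dom src v v∈V′ (inj₂ (inj₂ eq)) = [ inj₁ , inj₂ ∘ inj₂ ]′ (src v v∈V′ eq)

  Tracks : List (Fin n) → ℕ → Set
  Tracks ps r = length ps ≡ r × Dominates ps r

  Covers : List (Fin n) → Set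
  Covers ps = ∀ v → v ∈ V′ → Fire G ps (length ps) v

  State : ℕ → Set
  State r = Σ (List (Fin n)) λ ps → ValidSources G ps × length ps ≤ r × (Tracks ps r ⊎ Covers ps)

  extend : ∀ {ps r} c → ValidSources G ps → Tracks ps r → c ∈ V′ → ¬ Fire G ps r c →
           (∀ v → v ∈ V′ → nth us r ≡ just v → Fire G ps r v ⊎ v ≡ c) → State (suc r)
  extend {ps} {r} c valid (refl , dom) c∈V′ c-unburnt src =
    ps ∷ʳ c , ValidSources-∷ʳ G valid c∈V′ c-unburnt , ≤-reflexive (length-∷ʳ ps c) ,
    inj₁ (length-∷ʳ ps c , dominates-suc r dom′ src′)
    where
    dom′ : Dominates (ps ∷ʳ c) r
    dom′ v v∈V′ f = Fire-∷ʳ⁺ G ps c ≤-refl (dom v v∈V′ f)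
    src′ : ∀ v → v ∈ V′ → nth us r ≡ just v → Fire G (ps ∷ʳ c) r v ⊎ nth (ps ∷ʳ c) r ≡ just v
    src′ v v∈V′ eq with src v v∈V′ eq
    ... | inj₁ f    = inj₁ (Fire-∷ʳ⁺ G ps c ≤-refl f)
    ... | inj₂ refl = inj₂ (nth-∷ʳ-length ps c)

  unburnt? : ∀ ps r → Dec (∃ λ w → w ∈ V′ × ¬ Fire G ps r w)
  unburnt? ps r = anyFin? λ w → (w ∈? V′) ×-dec ¬? (fire? G ps r w)

  state : ∀ r → State r
  state zero = [] , (λ _ _ ()) , z≤n , inj₁ (refl , λ _ _ ())
  state (suc r) with state r
  ... | ps , valid , len≤ , inj₂ covers = ps , valid , m≤n⇒m≤1+n len≤ , inj₂ covers
  ... | ps , valid , len≤ , inj₁ tracks@(refl , _) with unburnt? ps r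
  ...   | yes (w , w∈V′ , w-unburnt) =
    let c , c∈V′ , c-unburnt , src = preferSource V′ (fire? G ps r) (nth us r) w w∈V′ w-unburnt
    in  extend c valid tracks c∈V′ c-unburnt src
  ...   | no none = ps , valid , m≤n⇒m≤1+n len≤ ,
    inj₂ λ v v∈V′ → decidable-stable (fire? G ps r v) λ v-unburnt → none (v , v∈V′ , v-unburnt)

  burningSeq : IsBurningSeq H us → Σ (List (Fin n)) λ ps → IsBurningSeq G ps × length ps ≤ length us
  burningSeq (_ , coversH) with state (length us)
  ... | ps , valid , len≤ , final = ps , isBurningSeq G valid (covers final) , len≤
    where
    covers : Tracks ps (length us) ⊎ Covers ps → Covers ps
    covers (inj₁ (len≡ , dom)) v v∈V′ =
      subst (λ r → Fire G ps r v) (sym len≡) (dom v v∈V′ (proj₁ (coversH v) (sub v∈V′)))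
    covers (inj₂ covered)             = covered

mainTheorem19 : ∀ {n} (H : Hypergraph n) (V' : Subset n)
                (ne : Nonempty V') (sub : V' ⊆ V H) →
                let G = weakInduced H V' ne sub in
                length (E G) ≡ length (E H) →
                All (λ e → ∣ e ∣ ≢ 1) (E G) →
                ∀ bG bH → IsBurningNumber G bG → IsBurningNumber H bH → bG ≤ bH
mainTheorem19 H V' ne sub _ noSingleton _ _ (_ , minimalG) ((us , burnsH , refl) , _)
  with Simulation.burningSeq H V' ne sub noSingleton us burnsH
... | ps , burnsG , ps≤us = ≤-trans (minimalG ps burnsG) ps≤us
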